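{- Let $n\ge1$ and let $\mathbf{x},\mathbf{y}\in\{0,1\}^n$ with $x_1=y_1=1$. If $\operatorname{code}(\mathbf{x})<\operatorname{code}(\mathbf{y})$, then $\lambda^\#(\operatorname{code}(\mathbf{x}))<\lambda^\#(\operatorname{code}(\mathbf{y}))$.
   Context: For $\mathbf{x}\in\{0,1\}^n$, let $\lambda(\mathbf{x})\in\{0,1\}^{\binom n2}$ have coordinates $\lambda(\mathbf{x})_{ij}=\mathbf{1}(x_i=x_j)$ for $1\le i<j\le n$, listed in lexicographic order of the pairs $(i,j)$. For a binary vector $\mathbf{y}=(y_1,\dots,y_m)$, $\operatorname{code}(\mathbf{y})=\sum_{j=1}^m y_j2^{m-j}$. For $0\le a<2^n$, $\mathrm{decode}_n(a)$ is the $n$-bit binary representation of $a$, padded with leading zeros. Then $\lambda^\#(a):=\operatorname{code}(\lambda(\mathrm{decode}_n(a)))$. -}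

module Defs where

open import Data.Bool using (Bool; true; false; if_then_else_)
open import Data.Nat using (ℕ; zero; suc; _+_; _*_; _^_)
open import Data.Nat.DivMod using (_/_; _%_)
open import Data.List using (List; []; _∷_; _++_; map; concatMap)
open import Data.Vec using (Vec; []; _∷_; toList; lookup; _∷ʳ_)
open import Data.Fin using (Fin)
open import Data.Bool.Properties using () renaming (_≟_ to _≟B_)
open import Relation.Nullary.Decidable using (⌊_⌋)

-- code(y) = Σ_j y_j 2^(m-j)  (most significant bit first)
bitVal : Bool → ℕ
bitVal true  = 1
bitVal false = 0

codeAcc : ℕ → List Bool → ℕ
codeAcc acc []       = acc
codeAcc acc (b ∷ bs) = codeAcc (2 * acc + bitVal b) bs

code : List Bool → ℕ
code = codeAcc 0

decode : (n : ℕ) → ℕ → Vec Bool n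
decode zero    a = []
decode (suc n) a = decode n (a / 2) ∷ʳ ⌊ a % 2 Data.Nat.≟ 1 ⌋

-- λ(x)_{ij} = 1(x_i = x_j), i<j, pairs in lexicographic order
lamList : List Bool → List Bool
lamList []       = []
lamList (b ∷ bs) = map (λ c → ⌊ b ≟B c ⌋) bs ++ lamList bs

lam : {n : ℕ} → Vec Bool n → List Bool
lam x = lamList (toList x)

lamHash : (n : ℕ) → ℕ → ℕ
lamHash n a = code (lam (decode n a))

-- The first row of λ(x) compares x₁ = 1 with x₂ … xₙ, so it is x₂ … xₙ itself.
-- Hence λ(x) = (x₂ … xₙ) ++ λ(x₂ … xₙ), and the leading block decides the
-- comparison: the codes of the tails compare like code(x) and code(y), and the
-- remaining blocks have the same length binom(n-1, 2).
{-# OPTIONS --safe #-}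
module Submission where

open import Defs
open import Data.Bool using (Bool; true; false)
open import Data.Bool.Properties using () renaming (_≟_ to _≟B_)
open import Data.Nat using (ℕ; zero; suc; _<_; _≤_; _+_; _*_; _^_; _≟_; s≤s; z≤n)
open import Data.Nat.Properties
open import Data.Nat.DivMod using (_/_; _%_; m*n/n≡m; +-distrib-/-∣ˡ; [m+kn]%n≡m%n)
open import Data.Nat.Divisibility using (n∣m*n)
open import Data.Nat.Combinatorics using (_C_; nC1≡n; nCk+nC[k+1]≡[n+1]C[k+1])
open import Data.Nat.Tactic.RingSolver using (solve-∀)
open import Data.List using (List; []; _∷_; _++_; length; map)
open import Data.List.Properties using (length-++; length-map; map-cong; map-id)
open import Data.Vec using (Vec; []; _∷_; toList; head; _∷ʳ_; initLast)
open import Data.Vec.Properties using (toList-∷ʳ; length-toList)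
open import Data.Product using (_,_)
open import Relation.Binary.PropositionalEquality
open import Relation.Nullary.Decidable using (⌊_⌋)

codeAcc-++ : ∀ acc xs ys → codeAcc acc (xs ++ ys) ≡ codeAcc (codeAcc acc xs) ys
codeAcc-++ acc []       ys = refl
codeAcc-++ acc (x ∷ xs) ys = codeAcc-++ _ xs ys

codeAcc≡*2^length+code : ∀ acc ys → codeAcc acc ys ≡ acc * 2 ^ length ys + code ys
codeAcc≡*2^length+code acc []       = sym (trans (+-identityʳ (acc * 1)) (*-identityʳ acc))
codeAcc≡*2^length+code acc (b ∷ ys) = begin
  codeAcc (2 * acc + bitVal b) ys
    ≡⟨ codeAcc≡*2^length+code _ ys ⟩
  (2 * acc + bitVal b) * 2 ^ k + code ys
    ≡⟨ shift acc (bitVal b) (2 ^ k) (code ys) ⟩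
  acc * 2 ^ suc k + (bitVal b * 2 ^ k + code ys)
    ≡⟨ cong (acc * 2 ^ suc k +_) (codeAcc≡*2^length+code (bitVal b) ys) ⟨
  acc * 2 ^ suc k + codeAcc (bitVal b) ys
    ∎
  where
  open ≡-Reasoning
  k = length ys
  shift : ∀ a r p c → (2 * a + r) * p + c ≡ a * (2 * p) + (r * p + c)
  shift = solve-∀

code-++ : ∀ xs ys → code (xs ++ ys) ≡ code xs * 2 ^ length ys + code ys
code-++ xs ys = trans (codeAcc-++ 0 xs ys) (codeAcc≡*2^length+code (code xs) ys)

bitVal≤1 : ∀ b → bitVal b ≤ 1
bitVal≤1 true  = s≤s z≤n
bitVal≤1 false = z≤n

code<2^length : ∀ ys → code ys < 2 ^ length ys
code<2^length []       = s≤s z≤n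
code<2^length (b ∷ ys) = begin-strict
  codeAcc (bitVal b) ys      ≡⟨ codeAcc≡*2^length+code (bitVal b) ys ⟩
  bitVal b * 2 ^ k + code ys <⟨ +-monoʳ-< (bitVal b * 2 ^ k) (code<2^length ys) ⟩
  bitVal b * 2 ^ k + 2 ^ k   ≤⟨ +-monoˡ-≤ (2 ^ k) (*-monoˡ-≤ (2 ^ k) (bitVal≤1 b)) ⟩
  1 * 2 ^ k + 2 ^ k          ≡⟨ cong (_+ 2 ^ k) (*-identityˡ (2 ^ k)) ⟩
  2 ^ k + 2 ^ k              ≡⟨ cong (2 ^ k +_) (+-identityʳ (2 ^ k)) ⟨
  2 ^ suc k                  ∎
  where
  open ≤-Reasoning
  k = length ys

*+-lex-< : ∀ {a b c p} d → a < b → c < p → a * p + c < b * p + d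
*+-lex-< {a} {b} {c} {p} d a<b c<p = begin-strict
  a * p + c  <⟨ +-monoʳ-< (a * p) c<p ⟩
  a * p + p  ≡⟨ +-comm (a * p) p ⟩
  suc a * p  ≤⟨ *-monoˡ-≤ p a<b ⟩
  b * p      ≤⟨ m≤m+n (b * p) d ⟩
  b * p + d  ∎
  where open ≤-Reasoning

code-++-< : ∀ a b c d → length c ≡ length d →
            code a < code b → code (a ++ c) < code (b ++ d)
code-++-< a b c d |c|≡|d| a<b = begin-strict
  code (a ++ c)                   ≡⟨ code-++ a c ⟩
  code a * 2 ^ length c + code c  <⟨ *+-lex-< (code d) a<b (code<2^length c) ⟩
  code b * 2 ^ length c + code d  ≡⟨ cong (λ k → code b * 2 ^ k + code d) |c|≡|d| ⟩
  code b * 2 ^ length d + code d  ≡⟨ code-++ b d ⟨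
  code (b ++ d)                   ∎
  where open ≤-Reasoning

bitVal/2≡0 : ∀ b → bitVal b / 2 ≡ 0
bitVal/2≡0 true  = refl
bitVal/2≡0 false = refl

[c*2+bitVal]/2≡c : ∀ c b → (c * 2 + bitVal b) / 2 ≡ c
[c*2+bitVal]/2≡c c b = begin
  (c * 2 + bitVal b) / 2      ≡⟨ +-distrib-/-∣ˡ (bitVal b) (n∣m*n c) ⟩
  c * 2 / 2 + bitVal b / 2    ≡⟨ cong₂ _+_ (m*n/n≡m c 2) (bitVal/2≡0 b) ⟩
  c + 0                       ≡⟨ +-identityʳ c ⟩
  c                           ∎
  where open ≡-Reasoning

lowBit-[c*2+bitVal] : ∀ c b → ⌊ (c * 2 + bitVal b) % 2 ≟ 1 ⌋ ≡ b
lowBit-[c*2+bitVal] c b = begin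
  ⌊ (c * 2 + bitVal b) % 2 ≟ 1 ⌋
    ≡⟨ cong (λ r → ⌊ r % 2 ≟ 1 ⌋) (+-comm (c * 2) (bitVal b)) ⟩
  ⌊ (bitVal b + c * 2) % 2 ≟ 1 ⌋
    ≡⟨ cong (λ r → ⌊ r ≟ 1 ⌋) ([m+kn]%n≡m%n (bitVal b) c 2) ⟩
  ⌊ bitVal b % 2 ≟ 1 ⌋
    ≡⟨ lowBit-bitVal b ⟩
  b
    ∎
  where
  open ≡-Reasoning
  lowBit-bitVal : ∀ b → ⌊ bitVal b % 2 ≟ 1 ⌋ ≡ b
  lowBit-bitVal true  = refl
  lowBit-bitVal false = refl

code-toList-∷ʳ : ∀ {n} (v : Vec Bool n) b →
                 code (toList (v ∷ʳ b)) ≡ code (toList v) * 2 + bitVal b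
code-toList-∷ʳ v b = trans (cong code (toList-∷ʳ b v)) (code-++ (toList v) (b ∷ []))

decode-code : ∀ n (v : Vec Bool n) → decode n (code (toList v)) ≡ v
decode-code zero    []  = refl
decode-code (suc n) v with initLast v
... | u , b , refl = begin
  decode (suc n) (code (toList (u ∷ʳ b)))
    ≡⟨ cong (decode (suc n)) (code-toList-∷ʳ u b) ⟩
  decode n ((c * 2 + bitVal b) / 2) ∷ʳ ⌊ (c * 2 + bitVal b) % 2 ≟ 1 ⌋
    ≡⟨ cong₂ _∷ʳ_ (trans (cong (decode n) ([c*2+bitVal]/2≡c c b)) (decode-code n u))
                  (lowBit-[c*2+bitVal] c b) ⟩
  u ∷ʳ b
    ∎
  where
  open ≡-Reasoning
  c = code (toList u)

lamList-true∷ : ∀ l → lamList (true ∷ l) ≡ l ++ lamList l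
lamList-true∷ l = cong (_++ lamList l) (trans (map-cong true≟B-is-id l) (map-id l))
  where
  true≟B-is-id : ∀ c → ⌊ true ≟B c ⌋ ≡ c
  true≟B-is-id true  = refl
  true≟B-is-id false = refl

length-lamList : ∀ (l : List Bool) → length (lamList l) ≡ length l C 2
length-lamList []      = refl
length-lamList (b ∷ l) = begin
  length (map _ l ++ lamList l)
    ≡⟨ length-++ (map _ l) ⟩
  length (map _ l) + length (lamList l)
    ≡⟨ cong₂ _+_ (trans (length-map _ l) (sym (nC1≡n k))) (length-lamList l) ⟩
  k C 1 + k C 2
    ≡⟨ nCk+nC[k+1]≡[n+1]C[k+1] k 1 ⟩
  suc k C 2
    ∎
  where
  open ≡-Reasoning
  k = length l

code-true∷ : ∀ {m} (w : Vec Bool m) → code (toList (true ∷ w)) ≡ 2 ^ m + code (toList w)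
code-true∷ {m} w = begin
  codeAcc 1 (toList w)
    ≡⟨ codeAcc≡*2^length+code 1 (toList w) ⟩
  1 * 2 ^ length (toList w) + code (toList w)
    ≡⟨ cong (λ k → 1 * 2 ^ k + code (toList w)) (length-toList w) ⟩
  1 * 2 ^ m + code (toList w)
    ≡⟨ cong (_+ code (toList w)) (*-identityˡ (2 ^ m)) ⟩
  2 ^ m + code (toList w)
    ∎
  where open ≡-Reasoning

lamHash-true∷ : ∀ {m} (w : Vec Bool m) →
  lamHash (suc m) (code (toList (true ∷ w))) ≡ code (toList w ++ lamList (toList w))
lamHash-true∷ {m} w = begin
  code (lam (decode (suc m) (code (toList (true ∷ w)))))
    ≡⟨ cong (λ v → code (lam v)) (decode-code (suc m) (true ∷ w)) ⟩
  code (lamList (true ∷ toList w))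
    ≡⟨ cong code (lamList-true∷ (toList w)) ⟩
  code (toList w ++ lamList (toList w))
    ∎
  where open ≡-Reasoning

proposition2 : (m : ℕ) (x y : Vec Bool (suc m)) →
    head x ≡ true → head y ≡ true →
    code (toList x) < code (toList y) →
    lamHash (suc m) (code (toList x)) < lamHash (suc m) (code (toList y))
proposition2 m (true ∷ u) (true ∷ w) refl refl x<y =
  subst₂ _<_ (sym (lamHash-true∷ u)) (sym (lamHash-true∷ w))
    (code-++-< (toList u) (toList w) (lamList (toList u)) (lamList (toList w)) same-length u<w)
  where
  u<w : code (toList u) < code (toList w)
  u<w = +-cancelˡ-< (2 ^ m) _ _ (subst₂ _<_ (code-true∷ u) (code-true∷ w) x<y)
  same-length : length (lamList (toList u)) ≡ length (lamList (toList w))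
  same-length = begin
    length (lamList (toList u))  ≡⟨ length-lamList (toList u) ⟩
    length (toList u) C 2        ≡⟨ cong (_C 2) (length-toList u) ⟩
    m C 2                        ≡⟨ cong (_C 2) (length-toList w) ⟨
    length (toList w) C 2        ≡⟨ length-lamList (toList w) ⟨
    length (lamList (toList w))  ∎
    where open ≡-Reasoning
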